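{- Let $L$ be a planar triangulation with $n_L\ge 3$ vertices, embedded in the plane, and let $H$ be its planar conjugated triangulation. If $v$ is a cut vertex of $H$, then $v$ has degree $4$ in $H$.
   Context: A planar triangulation is a maximal planar simple graph; fix a plane embedding of $L$, so all faces of $L$ are triangles. The planar conjugated triangulation $H$ of $L$ is the plane graph whose vertices are the midpoints of the edges of $L$, and in which, for every bounded face of $L$, the three midpoints of its three boundary edges are joined pairwise by three segments drawn inside that face; nothing is drawn inside the unbounded face of $L$. A cut vertex is a vertex whose removal increases the number of connected components. -}

module Defs where

open import Data.Nat using (ℕ; zero; suc; _+_; _*_; _≤ᵇ_)
open import Data.Fin using (Fin; toℕ)
import Data.Fin as Fin
open import Data.Bool using (Bool; true; false; not; _∧_; if_then_else_; T)
import Data.Bool as Bool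
open import Data.Product using (_×_; _,_; proj₁; proj₂; ∃; Σ)
open import Data.Product.Properties using (≡-dec)
open import Data.List using (List; []; _∷_; allFin; upTo; filterᵇ; length; concatMap)
open import Data.Bool.ListAction using (all; any)
open import Relation.Binary.PropositionalEquality using (_≡_; _≢_)
open import Relation.Nullary using (¬_)
open import Relation.Nullary.Decidable using (⌊_⌋)
open import Function using (_∘_)
open import Function.Definitions using (Injective)

-- A map with m edges has darts (half-edges) Dart m = Fin m × Bool:
-- dart (e , b) is one of the two ends of edge e.  The edge involution
-- α flips the Bool.  σ is the rotation (a permutation of the darts);
-- vertices are σ-orbits, faces are φ-orbits where φ = σ ∘ α.

Dart : ℕ → Set
Dart m = Fin m × Bool

α : ∀ {m} → Dart m → Dart m
α (e , b) = e , not b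

darts : (m : ℕ) → List (Dart m)
darts m = concatMap (λ e → (e , false) ∷ (e , true) ∷ []) (allFin m)

_==D_ : ∀ {m} → Dart m → Dart m → Bool
x ==D y = ⌊ ≡-dec Fin._≟_ Bool._≟_ x y ⌋

_==F_ : ∀ {m} → Fin m → Fin m → Bool
e ==F e' = ⌊ e Fin.≟ e' ⌋

iter : ∀ {A : Set} → ℕ → (A → A) → A → A
iter zero    f x = x
iter (suc k) f x = f (iter k f x)

-- a numeric code of a dart, used to pick one representative per orbit
code : ∀ {m} → Dart m → ℕ
code (e , b) = 2 * toℕ e + (if b then 1 else 0)

-- x is the code-minimal dart of its f-orbit (orbits have length ≤ 2m)
isOrbitMin : ∀ {m} → (Dart m → Dart m) → Dart m → Bool
isOrbitMin {m} f x = all (λ k → code x ≤ᵇ code (iter k f x)) (upTo (2 * m))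

numOrbits : (m : ℕ) → (Dart m → Dart m) → ℕ
numOrbits m f = length (filterᵇ (isOrbitMin f) (darts m))

SameOrbit : ∀ {m} → (Dart m → Dart m) → Dart m → Dart m → Set
SameOrbit f x y = ∃ λ k → iter k f x ≡ y

record Map (m : ℕ) : Set where
  field
    σ     : Dart m → Dart m
    σ-inj : Injective _≡_ _≡_ σ     -- hence a permutation (finite set)

  φ : Dart m → Dart m
  φ = σ ∘ α

  nV : ℕ
  nV = numOrbits m σ

  nF : ℕ
  nF = numOrbits m φ

data Reach {m} (M : Map m) (x : Dart m) : Dart m → Set where
  here  : Reach M x x
  stepσ : ∀ {y} → Reach M x y → Reach M x (Map.σ M y)
  stepα : ∀ {y} → Reach M x y → Reach M x (α y)

-- The map M (on the sphere) is a triangulation of a simple graph: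
-- connected, genus 0 (Euler's formula), all faces triangles,
-- no loops, no multiple edges.
record IsSphereTriangulation {m} (M : Map m) : Set where
  open Map M
  field
    connected   : ∀ x y → Reach M x y
    euler       : nV + nF ≡ m + 2
    faceLength3 : ∀ x → iter 3 φ x ≡ x
    faceNonTriv : ∀ x → φ x ≢ x
    noLoop      : ∀ x → ¬ SameOrbit σ x (α x)
    noMulti     : ∀ x y → proj₁ x ≢ proj₁ y → SameOrbit σ x y →
                  ¬ SameOrbit σ (α x) (α y)

-- The conjugated triangulation H of (M, outer face containing dart o).
-- Vertices of H are the edges Fin m of L.  Two distinct edges are
-- adjacent iff they lie on a common bounded face.

module Conjugate {m} (M : Map m) (o : Dart m) where
  open Map M

  inOuter : Dart m → Bool
  inOuter x = any (λ k → iter k φ o ==D x) (upTo 3)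

  faceHasEdge : Dart m → Fin m → Bool
  faceHasEdge x e' = any (λ k → proj₁ (iter k φ x) ==F e') (upTo 3)

  adjH : Fin m → Fin m → Bool
  adjH e e' = not (e ==F e') ∧
              any (λ b → not (inOuter (e , b)) ∧ faceHasEdge (e , b) e')
                  (false ∷ true ∷ [])

  degH : Fin m → ℕ
  degH e = length (filterᵇ (adjH e) (allFin m))

  data PathH (u : Fin m) : Fin m → Set where
    here : PathH u u
    step : ∀ {w w'} → PathH u w → T (adjH w w') → PathH u w'

  data PathAvoid (v u : Fin m) : Fin m → Set where
    here : u ≢ v → PathAvoid v u u
    step : ∀ {w w'} → PathAvoid v u w → T (adjH w w') → w' ≢ v →
           PathAvoid v u w'

  -- v is a cut vertex: removing v disconnects two vertices that were
  -- connected in H (i.e. the number of components increases)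
  IsCutVertex : Fin m → Set
  IsCutVertex v = Σ (Fin m) λ u → Σ (Fin m) λ w →
    u ≢ v × w ≢ v × PathH u w × ¬ PathAvoid v u w

-- The vertices of H are the edges of L.  If both faces at an edge e are
-- bounded, e is H-adjacent exactly to the other four edges of those two
-- triangles, and these four are distinct: a coincidence would give a loop or a
-- double edge in L, or would glue the two triangles along all three edges, so
-- that by connectivity L is a single triangle whose two faces include the
-- outer one.  If instead e lies on the outer face, its H-neighbours are the two
-- other edges of its bounded face, which are H-adjacent to each other; a vertex
-- whose neighbourhood is a clique is never a cut vertex.
module Submission where

open import Defs
open import Data.Bool using (Bool; true; false; not; _∧_; T)
open import Data.Bool.Properties using (T-∧; T?)
open import Data.Empty using (⊥; ⊥-elim)
open import Data.Fin using (Fin; toℕ; _≟_)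
open import Data.Fin.Properties using (pigeonhole; *↔×; 2↔Bool)
open import Data.List using (List; []; _∷_; length; filter; allFin)
open import Data.List.Properties using (filter-≐; filter-accept; filter-reject; filter-none)
open import Data.List.Membership.Propositional using (_∈_)
open import Data.List.Membership.Propositional.Properties using (∈-allFin)
open import Data.List.Relation.Binary.Subset.Propositional using (_⊆_)
open import Data.List.Relation.Unary.Any as Any using (Any; here; there)
open import Data.List.Relation.Unary.Any.Properties using (any⁺; any⁻)
open import Data.List.Relation.Unary.All as All using ([]; _∷_)
open import Data.List.Relation.Unary.Unique.Propositional using (Unique; []; _∷_)
open import Data.List.Relation.Unary.Unique.Propositional.Properties using (allFin⁺)
open import Data.Nat using (ℕ; zero; suc; _+_; _*_; _≤_)
open import Data.Nat.Properties using (+-suc; +-comm; *-suc; m≤n⇒∃[o]m+o≡n; n<1+n)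
open import Data.Product using (_×_; _,_; proj₁; proj₂; ∃; Σ-syntax)
open import Data.Product.Function.NonDependent.Propositional using (_×-↔_)
import Data.Sum as Sum
open import Data.Sum using (_⊎_; inj₁; inj₂)
open import Function using (_∘_; _⇔_; mk⇔; Equivalence; _↣_; Injection)
open import Function.Construct.Composition using (_↔-∘_)
open import Function.Construct.Identity using (↔-id)
open import Function.Definitions using (Injective)
open import Function.Properties.Inverse using (↔-sym; ↔⇒↣)
open import Level using (0ℓ)
open import Relation.Binary.Definitions using (DecidableEquality)
open import Relation.Binary.PropositionalEquality
open import Relation.Nullary using (¬_; Dec; yes; no)
open import Relation.Nullary.Decidable using (toWitness; fromWitness; toWitnessFalse; fromWitnessFalse)
import Relation.Nullary.Decidable as Dec
open import Relation.Unary using (Pred; Decidable; _≐_; _∪_)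
open import Relation.Unary.Properties using (_∪?_)

open ≡-Reasoning

iter-+ : ∀ {A : Set} (f : A → A) a b x → iter (a + b) f x ≡ iter a f (iter b f x)
iter-+ f zero    b x = refl
iter-+ f (suc a) b x = cong f (iter-+ f a b x)

iter-injective : ∀ {A : Set} {f : A → A} → Injective _≡_ _≡_ f →
                 ∀ k {x y} → iter k f x ≡ iter k f y → x ≡ y
iter-injective inj zero    eq = eq
iter-injective inj (suc k) eq = iter-injective inj k (inj eq)

iter-*-period : ∀ {A : Set} (f : A → A) {x} n → iter (suc n) f x ≡ x →
                ∀ k → iter (k * suc n) f x ≡ x
iter-*-period f n period zero    = refl
iter-*-period f {x} n period (suc k) = begin
  iter (suc n + k * suc n) f x         ≡⟨ iter-+ f (suc n) (k * suc n) x ⟩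
  iter (suc n) f (iter (k * suc n) f x) ≡⟨ cong (iter (suc n) f) (iter-*-period f n period k) ⟩
  iter (suc n) f x                     ≡⟨ period ⟩
  x                                    ∎

-- Pigeonhole on x, f x, …, f^N x; injectivity then cancels the common prefix.
iter-periodic : ∀ {A : Set} {N} → A ↣ Fin N → {f : A → A} → Injective _≡_ _≡_ f →
                ∀ x → ∃ λ n → iter (suc n) f x ≡ x
iter-periodic {N = N} enc {f} inj x
  with i , j , i<j , same ← pigeonhole (n<1+n N) (λ i → Injection.to enc (iter (toℕ i) f x))
  with k , i+1+k≡j ← m≤n⇒∃[o]m+o≡n i<j
  = k , iter-injective inj (toℕ i) (begin
      iter (toℕ i) f (iter (suc k) f x) ≡⟨ sym (iter-+ f (toℕ i) (suc k) x) ⟩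
      iter (toℕ i + suc k) f x          ≡⟨ cong (λ n → iter n f x) (trans (+-suc (toℕ i) k) i+1+k≡j) ⟩
      iter (toℕ j) f x                  ≡⟨ sym (Injection.injective enc same) ⟩
      iter (toℕ i) f x                  ∎)

dart↣Fin : ∀ {m} → Dart m ↣ Fin (m * 2)
dart↣Fin = ↔⇒↣ (↔-sym ((↔-id _ ×-↔ 2↔Bool) ↔-∘ *↔×))

SameOrbit-sym : ∀ {m} {f : Dart m → Dart m} → Injective _≡_ _≡_ f →
                ∀ {x y} → SameOrbit f x y → SameOrbit f y x
SameOrbit-sym {f = f} inj {x} (k , refl) with n , period ← iter-periodic dart↣Fin inj x
  = k * n , (begin
      iter (k * n) f (iter k f x) ≡⟨ sym (iter-+ f (k * n) k x) ⟩
      iter (k * n + k) f x        ≡⟨ cong (λ t → iter t f x) (trans (+-comm (k * n) k) (sym (*-suc k n))) ⟩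
      iter (k * suc n) f x        ≡⟨ iter-*-period f n period k ⟩
      x                           ∎)

length-filter-∪ : ∀ {A : Set} {P Q : Pred A 0ℓ} (P? : Decidable P) (Q? : Decidable Q) →
                  (∀ {z} → P z → Q z → ⊥) → ∀ zs →
                  length (filter (P? ∪? Q?) zs) ≡ length (filter P? zs) + length (filter Q? zs)
length-filter-∪ P? Q? disjoint [] = refl
length-filter-∪ P? Q? disjoint (z ∷ zs) with P? z | Q? z
... | yes pz | yes qz = ⊥-elim (disjoint pz qz)
... | yes _  | no _   = cong suc (length-filter-∪ P? Q? disjoint zs)
... | no _   | yes _  = trans (cong suc (length-filter-∪ P? Q? disjoint zs)) (sym (+-suc _ _))
... | no _   | no _   = length-filter-∪ P? Q? disjoint zs

module _ {A : Set} (_≟ᴬ_ : DecidableEquality A) where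
  open import Data.List.Membership.DecPropositional _≟ᴬ_ using (_∈?_)

  length-filter-≡ : ∀ {a ys} → Unique ys → a ∈ ys → length (filter (_≟ᴬ a) ys) ≡ 1
  length-filter-≡ {a} {_ ∷ ys} (a∉ys ∷ _) (here refl) = begin
    length (filter (_≟ᴬ a) (a ∷ ys)) ≡⟨ cong length (filter-accept (_≟ᴬ a) refl) ⟩
    suc (length (filter (_≟ᴬ a) ys)) ≡⟨ cong (suc ∘ length) (filter-none (_≟ᴬ a) (All.map (λ a≢z → a≢z ∘ sym) a∉ys)) ⟩
    1                                ∎
  length-filter-≡ {a} {y ∷ ys} (y∉ys ∷ uys) (there a∈ys) = begin
    length (filter (_≟ᴬ a) (y ∷ ys)) ≡⟨ cong length (filter-reject (_≟ᴬ a) (All.lookup y∉ys a∈ys)) ⟩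
    length (filter (_≟ᴬ a) ys)       ≡⟨ length-filter-≡ uys a∈ys ⟩
    1                                ∎

  length-filter-∈ : ∀ {xs ys} → Unique xs → Unique ys → xs ⊆ ys →
                    length (filter (_∈? xs) ys) ≡ length xs
  length-filter-∈ {[]} {ys} _ _ _ = cong length (filter-none (_∈? []) (All.universal (λ _ ()) ys))
  length-filter-∈ {a ∷ xs} {ys} (a∉xs ∷ uxs) uys xs⊆ys = begin
    length (filter (_∈? a ∷ xs) ys)
      ≡⟨ cong length (filter-≐ (_∈? a ∷ xs) ((_≟ᴬ a) ∪? (_∈? xs)) ∈-∷≐ ys) ⟩
    length (filter ((_≟ᴬ a) ∪? (_∈? xs)) ys)
      ≡⟨ length-filter-∪ (_≟ᴬ a) (_∈? xs) (λ { refl a∈xs → All.lookup a∉xs a∈xs refl }) ys ⟩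
    length (filter (_≟ᴬ a) ys) + length (filter (_∈? xs) ys)
      ≡⟨ cong₂ _+_ (length-filter-≡ uys (xs⊆ys (here refl))) (length-filter-∈ uxs uys (xs⊆ys ∘ there)) ⟩
    suc (length xs)
      ∎
    where
    ∈-∷≐ : (_∈ a ∷ xs) ≐ ((_≡ a) ∪ (_∈ xs))
    ∈-∷≐ = (λ { (here z≡a) → inj₁ z≡a ; (there z∈xs) → inj₂ z∈xs })
         , (λ { (inj₁ z≡a) → here z≡a ; (inj₂ z∈xs) → there z∈xs })

T-not⇔¬T : ∀ {b} → T (not b) ⇔ (¬ T b)
T-not⇔¬T {false} = mk⇔ (λ _ ()) _
T-not⇔¬T {true}  = mk⇔ (λ ()) (λ ¬t → ¬t _)

module _ {m} (M : Map m) (o : Dart m) where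
  open Conjugate M o

  module _ (adjH-sym : ∀ {a b} → T (adjH a b) → T (adjH b a))
           {v} (N : Fin m → Set) (nbr : ∀ {w} → T (adjH v w) → N w)
           (clique : ∀ {a b} → N a → N b → a ≢ b → T (adjH a b)) where

    -- A walk avoiding v is kept, and every passage a – v – b is replaced by the edge a – b.
    reroute : ∀ {u w} → u ≢ v → PathH u w →
              (w ≢ v × PathAvoid v u w) ⊎ (w ≡ v × Σ[ z ∈ Fin m ] N z × PathAvoid v u z)
    reroute u≢v here = inj₁ (u≢v , here u≢v)
    reroute u≢v (step {w' = w'} path adj) with reroute u≢v path | w' ≟ v
    ... | inj₁ (_ , avoid)       | no w'≢v  = inj₁ (w'≢v , step avoid adj w'≢v)
    ... | inj₁ (_ , avoid)       | yes refl = inj₂ (refl , _ , nbr (adjH-sym adj) , avoid)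
    ... | inj₂ (refl , last)     | yes refl = inj₂ (refl , last)
    ... | inj₂ (refl , z , Nz , avoid) | no w'≢v with z ≟ w'
    ...   | yes refl = inj₁ (w'≢v , avoid)
    ...   | no z≢w'  = inj₁ (w'≢v , step avoid (clique Nz (nbr adj) z≢w') w'≢v)

    simplicial⇒¬cut : ¬ IsCutVertex v
    simplicial⇒¬cut (u , w , u≢v , w≢v , path , ¬avoid) with reroute u≢v path
    ... | inj₁ (_ , avoid) = ¬avoid avoid
    ... | inj₂ (w≡v , _)   = w≢v w≡v

edge : ∀ {m} → Dart m → Fin m
edge = proj₁

α-involutive : ∀ {m} (x : Dart m) → α (α x) ≡ x
α-involutive (_ , false) = refl
α-involutive (_ , true)  = refl

α-≢ : ∀ {m} (x : Dart m) → α x ≢ x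
α-≢ (_ , false) ()
α-≢ (_ , true)  ()

α-swap : ∀ {m} {a b : Dart m} → a ≡ α b → α a ≡ b
α-swap {b = b} refl = α-involutive b

edge≡⇒≡⊎≡α : ∀ {m} {a b : Dart m} → edge a ≡ edge b → a ≡ b ⊎ a ≡ α b
edge≡⇒≡⊎≡α {a = _ , false} {_ , false} refl = inj₁ refl
edge≡⇒≡⊎≡α {a = _ , false} {_ , true}  refl = inj₂ refl
edge≡⇒≡⊎≡α {a = _ , true}  {_ , false} refl = inj₂ refl
edge≡⇒≡⊎≡α {a = _ , true}  {_ , true}  refl = inj₁ refl

darts-of-edge : ∀ {m} (x : Dart m) b → (edge x , b) ≡ x ⊎ (edge x , b) ≡ α x
darts-of-edge x b = edge≡⇒≡⊎≡α refl

SameOrbit₂ : ∀ {m} {f : Dart m → Dart m} {a b c} → f a ≡ b → f b ≡ c → SameOrbit f a c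
SameOrbit₂ {f = f} ab bc = 2 , trans (cong f ab) bc

SameOrbit₃ : ∀ {m} {f : Dart m → Dart m} {a b c d} → f a ≡ b → f b ≡ c → f c ≡ d → SameOrbit f a d
SameOrbit₃ {f = f} ab bc cd = 3 , trans (cong f (trans (cong f ab) bc)) cd

module Triangulation {m} {M : Map m} (TS : IsSphereTriangulation M) where
  open Map M
  open IsSphereTriangulation TS

  φ² : Dart m → Dart m
  φ² = φ ∘ φ

  φ³ : ∀ x → φ (φ² x) ≡ x
  φ³ = faceLength3

  σ≡φ∘α : ∀ w → σ w ≡ φ (α w)
  σ≡φ∘α w = cong σ (sym (α-involutive w))

  FaceOf : Dart m → Dart m → Set
  FaceOf x z = Any (λ k → iter k φ x ≡ z) (0 ∷ 1 ∷ 2 ∷ [])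

  FaceOf-φ : ∀ {x z} → FaceOf x z → FaceOf x (φ z)
  FaceOf-φ         (here refl)                 = there (here refl)
  FaceOf-φ         (there (here refl))         = there (there (here refl))
  FaceOf-φ {x = x} (there (there (here refl))) = here (sym (φ³ x))
  FaceOf-φ         (there (there (there ())))

  FaceOf-trans : ∀ {x y z} → FaceOf x y → FaceOf y z → FaceOf x z
  FaceOf-trans xy (here refl)                 = xy
  FaceOf-trans xy (there (here refl))         = FaceOf-φ xy
  FaceOf-trans xy (there (there (here refl))) = FaceOf-φ (FaceOf-φ xy)
  FaceOf-trans xy (there (there (there ())))

  FaceOf-sym : ∀ {x z} → FaceOf x z → FaceOf z x
  FaceOf-sym         (here refl)                 = here refl
  FaceOf-sym {x = x} (there (here refl))         = there (there (here (φ³ x)))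
  FaceOf-sym {x = x} (there (there (here refl))) = there (here (φ³ x))
  FaceOf-sym         (there (there (there ())))

  FaceOf-φ⁻ : ∀ {x z} → FaceOf x (φ z) → FaceOf x z
  FaceOf-φ⁻ {z = z} h = FaceOf-trans h (there (there (here (φ³ z))))

  edge-φ≢ : ∀ z → edge (φ z) ≢ edge z
  edge-φ≢ z e with edge≡⇒≡⊎≡α e
  ... | inj₁ φz≡z  = faceNonTriv z φz≡z
  ... | inj₂ φz≡αz = noLoop (α (σ z)) (SameOrbit₂ back (sym (α-involutive (σ z))))
    where
    back : φ (σ z) ≡ z
    back = trans (cong φ (trans (σ≡φ∘α z) (cong φ (sym φz≡αz)))) (φ³ z)

  edge-φ²≢ : ∀ z → edge (φ² z) ≢ edge z
  edge-φ²≢ z e = edge-φ≢ (φ² z) (trans (cong edge (φ³ z)) (sym e))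

  ¬FaceOf-α : ∀ x → ¬ FaceOf x (α x)
  ¬FaceOf-α x (here x≡αx)                 = α-≢ x (sym x≡αx)
  ¬FaceOf-α x (there (here φx≡αx))         = edge-φ≢ x (cong edge φx≡αx)
  ¬FaceOf-α x (there (there (here φ²x≡αx))) = edge-φ²≢ x (cong edge φ²x≡αx)
  ¬FaceOf-α x (there (there (there ())))

  reach-closed : (P : Dart m → Set) → (∀ {z} → P z → P (σ z)) → (∀ {z} → P z → P (α z)) →
                 ∀ {x y} → Reach M x y → P x → P y
  reach-closed P Pσ Pα here        px = px
  reach-closed P Pσ Pα (stepσ r) px = Pσ (reach-closed P Pσ Pα r px)
  reach-closed P Pσ Pα (stepα r) px = Pα (reach-closed P Pσ Pα r px)

  module _ (x : Dart m) where
    private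
      y = α x

    edge-φ≢edge-φα : edge (φ x) ≢ edge (φ y)
    edge-φ≢edge-φα e with edge≡⇒≡⊎≡α e
    ... | inj₁ same = α-≢ y (sym (σ-inj same))
    ... | inj₂ φx≡αφy = noLoop (α (φ² x)) (SameOrbit₃ (φ³ x) (σ≡φ∘α x) φy↦αα)
      where
      φy↦αα : σ (φ y) ≡ α (α (φ² x))
      φy↦αα = trans (σ≡φ∘α (φ y)) (trans (cong φ (sym φx≡αφy)) (sym (α-involutive (φ² x))))

    edge-φ²≢edge-φ²α : edge (φ² x) ≢ edge (φ² y)
    edge-φ²≢edge-φ²α e with edge≡⇒≡⊎≡α e
    ... | inj₁ same = α-≢ x (sym (trans (sym (φ³ x)) (trans (cong φ same) (φ³ y))))
    ... | inj₂ φ²x≡αφ²y = noLoop (α (φ x)) (SameOrbit₃ refl φ²x↦y (sym (α-involutive (φ x))))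
      where
      φ²x↦y : σ (φ² x) ≡ y
      φ²x↦y = trans (σ≡φ∘α (φ² x)) (trans (cong φ (α-swap φ²x≡αφ²y)) (φ³ y))

    φ≢φ²α : φ x ≢ φ² y
    φ≢φ²α φx≡φ²y = edge-φ²≢ x (cong edge (trans (cong φ φx≡φ²y) (φ³ y)))

    φ²≢φα : φ² x ≢ φ y
    φ²≢φα φ²x≡φy = edge-φ≢ x (cong edge (trans (cong φ x≡φ²y) (φ³ y)))
      where
      x≡φ²y : x ≡ φ² y
      x≡φ²y = trans (sym (φ³ x)) (cong φ φ²x≡φy)

    -- Two triangles sharing two edges share the third, since L has no double edge.
    edge-φ²≡edge-φα : φ x ≡ α (φ² y) → edge (φ² x) ≡ edge (φ y)
    edge-φ²≡edge-φα φx≡αφ²y with edge (φ² x) ≟ edge (φ y)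
    ... | yes same = same
    ... | no differ = ⊥-elim (noMulti (α (φ² x)) (φ y) differ
          (SameOrbit₂ (φ³ x) (σ≡φ∘α x))
          (SameOrbit-sym σ-inj (SameOrbit₂ (sym (α-swap φx≡αφ²y)) (sym (α-involutive (φ² x))))))

    edge-φ≡edge-φ²α : φ² x ≡ α (φ y) → edge (φ x) ≡ edge (φ² y)
    edge-φ≡edge-φ²α φ²x≡αφy with edge (φ x) ≟ edge (φ² y)
    ... | yes same = same
    ... | no differ = ⊥-elim (noMulti (α (φ² y)) (φ x) (differ ∘ sym)
          (SameOrbit₂ (φ³ y) refl)
          (SameOrbit-sym σ-inj (SameOrbit₂ φ²x≡αφy (sym (α-involutive (φ² y))))))

    -- The hypotheses glue the triangles at x and α x along all three edges; their six
    -- darts are then closed under σ and α, so by connectivity they contain o.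
    glued⇒outer : (o : Dart m) → φ x ≡ α (φ² y) → φ² x ≡ α (φ y) → FaceOf o x ⊎ FaceOf o y
    glued⇒outer o glue₁ glue₂ =
      Sum.map FaceOf-sym FaceOf-sym (reach-closed P P-σ P-α (connected x o) (inj₁ (here refl)))
      where
      P : Dart m → Set
      P z = FaceOf x z ⊎ FaceOf y z
      P-α : ∀ {z} → P z → P (α z)
      P-α (inj₁ (here refl))                 = inj₂ (here refl)
      P-α (inj₁ (there (here refl)))         = inj₂ (there (there (here (sym (α-swap glue₁)))))
      P-α (inj₁ (there (there (here refl)))) = inj₂ (there (here (sym (α-swap glue₂))))
      P-α (inj₁ (there (there (there ()))))
      P-α (inj₂ (here refl))                 = inj₁ (here (sym (α-involutive x)))
      P-α (inj₂ (there (here refl)))         = inj₁ (there (there (here glue₂)))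
      P-α (inj₂ (there (there (here refl)))) = inj₁ (there (here glue₁))
      P-α (inj₂ (there (there (there ()))))
      P-σ : ∀ {z} → P z → P (σ z)
      P-σ {z} pz = subst P (sym (σ≡φ∘α z)) (Sum.map FaceOf-φ FaceOf-φ (P-α pz))

  module _ (o : Dart m) where
    open Conjugate M o

    FaceNeighbour : Dart m → Fin m → Set
    FaceNeighbour z e = edge (φ z) ≡ e ⊎ edge (φ² z) ≡ e

    FaceNeighbour⇒≢ : ∀ {z e} → FaceNeighbour z e → edge z ≢ e
    FaceNeighbour⇒≢ {z} (inj₁ φz) z≡e = edge-φ≢ z (trans φz (sym z≡e))
    FaceNeighbour⇒≢ {z} (inj₂ φ²z) z≡e = edge-φ²≢ z (trans φ²z (sym z≡e))

    inOuter⇔ : ∀ {z} → T (inOuter z) ⇔ FaceOf o z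
    inOuter⇔ {z} = mk⇔ (Any.map toWitness ∘ any⁻ (λ k → iter k φ o ==D z) _)
                       (any⁺ (λ k → iter k φ o ==D z) ∘ Any.map fromWitness)

    FaceOf? : ∀ z → Dec (FaceOf o z)
    FaceOf? z = Dec.map inOuter⇔ (T? (inOuter z))

    faceHasEdge⇒ : ∀ {z e} → edge z ≢ e → T (faceHasEdge z e) → FaceNeighbour z e
    faceHasEdge⇒ {z} {e} z≢e t with any⁻ (λ k → edge (iter k φ z) ==F e) (0 ∷ 1 ∷ 2 ∷ []) t
    ... | here t₀                  = ⊥-elim (z≢e (toWitness t₀))
    ... | there (here t₁)          = inj₁ (toWitness t₁)
    ... | there (there (here t₂))  = inj₂ (toWitness t₂)
    ... | there (there (there ()))

    ⇒faceHasEdge : ∀ {z e} → FaceNeighbour z e → T (faceHasEdge z e)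
    ⇒faceHasEdge {z} {e} nb = any⁺ {xs = 0 ∷ 1 ∷ 2 ∷ []} (λ k → edge (iter k φ z) ==F e) (position nb)
      where
      position : FaceNeighbour z e → Any (λ k → T (edge (iter k φ z) ==F e)) (0 ∷ 1 ∷ 2 ∷ [])
      position (inj₁ φz)  = there (here (fromWitness φz))
      position (inj₂ φ²z) = there (there (here (fromWitness φ²z)))

    adjH⇒ : ∀ {e e'} → T (adjH e e') → Σ[ b ∈ Bool ] ¬ FaceOf o (e , b) × FaceNeighbour (e , b) e'
    adjH⇒ {e} {e'} t =
      let e≢e' , some   = Equivalence.to (T-∧ {not (e ==F e')}) t
          b , t'        = Any.satisfied (any⁻ (λ b → not (inOuter (e , b)) ∧ faceHasEdge (e , b) e')
                                              (false ∷ true ∷ []) some)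
          bounded , has = Equivalence.to (T-∧ {not (inOuter (e , b))}) t'
      in b , Equivalence.to T-not⇔¬T bounded ∘ Equivalence.from inOuter⇔
           , faceHasEdge⇒ (toWitnessFalse e≢e') has

    neighbour⇒adjH : ∀ {z e} → ¬ FaceOf o z → FaceNeighbour z e → T (adjH (edge z) e)
    neighbour⇒adjH {z} {e} bounded nb = Equivalence.from (T-∧ {not (edge z ==F e)})
      ( fromWitnessFalse (FaceNeighbour⇒≢ nb)
      , any⁺ (λ b → not (inOuter (edge z , b)) ∧ faceHasEdge (edge z , b) e) (at (proj₂ z) on-z) )
      where
      on-z : T (not (inOuter z) ∧ faceHasEdge z e)
      on-z = Equivalence.from (T-∧ {not (inOuter z)})
        (Equivalence.from T-not⇔¬T (bounded ∘ Equivalence.to inOuter⇔) , ⇒faceHasEdge nb)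
      at : ∀ {P : Bool → Set} b → P b → Any P (false ∷ true ∷ [])
      at false p = here p
      at true  p = there (here p)

    adjH-sym : ∀ {e e'} → T (adjH e e') → T (adjH e' e)
    adjH-sym t with adjH⇒ t
    ... | _ , bounded , inj₁ refl = neighbour⇒adjH (bounded ∘ FaceOf-φ⁻) (inj₂ (cong edge (φ³ _)))
    ... | _ , bounded , inj₂ refl = neighbour⇒adjH (bounded ∘ FaceOf-φ⁻ ∘ FaceOf-φ⁻) (inj₁ (cong edge (φ³ _)))

    adjH⇒neighbour : ∀ x {e} → T (adjH (edge x) e) →
                     (¬ FaceOf o x × FaceNeighbour x e) ⊎ (¬ FaceOf o (α x) × FaceNeighbour (α x) e)
    adjH⇒neighbour x {e} t with adjH⇒ t
    ... | b , found with darts-of-edge x b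
    ...   | inj₁ dart≡x  = inj₁ (subst (λ z → ¬ FaceOf o z × FaceNeighbour z e) dart≡x found)
    ...   | inj₂ dart≡αx = inj₂ (subst (λ z → ¬ FaceOf o z × FaceNeighbour z e) dart≡αx found)

    outer-edge-not-cut : ∀ {x} → FaceOf o x → ¬ IsCutVertex (edge x)
    outer-edge-not-cut {x} outer = simplicial⇒¬cut M o adjH-sym (FaceNeighbour (α x)) nbr clique
      where
      bounded : ¬ FaceOf o (α x)
      bounded outer' = ¬FaceOf-α x (FaceOf-trans (FaceOf-sym outer) outer')
      nbr : ∀ {w} → T (adjH (edge x) w) → FaceNeighbour (α x) w
      nbr t with adjH⇒neighbour x t
      ... | inj₁ (¬outer , _) = ⊥-elim (¬outer outer)
      ... | inj₂ (_ , nb)     = nb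
      link : T (adjH (edge (φ (α x))) (edge (φ² (α x))))
      link = neighbour⇒adjH (bounded ∘ FaceOf-φ⁻) (inj₁ refl)
      clique : ∀ {a b} → FaceNeighbour (α x) a → FaceNeighbour (α x) b → a ≢ b → T (adjH a b)
      clique (inj₁ refl) (inj₁ refl) a≢b = ⊥-elim (a≢b refl)
      clique (inj₁ refl) (inj₂ refl) _   = link
      clique (inj₂ refl) (inj₁ refl) _   = adjH-sym link
      clique (inj₂ refl) (inj₂ refl) a≢b = ⊥-elim (a≢b refl)

    module _ {x : Dart m} (bounded-x : ¬ FaceOf o x) (bounded-y : ¬ FaceOf o (α x)) where
      private
        y = α x

        not-glued : φ x ≡ α (φ² y) → φ² x ≡ α (φ y) → ⊥
        not-glued glue₁ glue₂ = Sum.[ bounded-x , bounded-y ]′ (glued⇒outer x o glue₁ glue₂)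

      edge-φ≢edge-φ²α : edge (φ x) ≢ edge (φ² y)
      edge-φ≢edge-φ²α e with edge≡⇒≡⊎≡α e
      ... | inj₁ φx≡φ²y = φ≢φ²α x φx≡φ²y
      ... | inj₂ φx≡αφ²y with edge≡⇒≡⊎≡α (edge-φ²≡edge-φα x φx≡αφ²y)
      ...   | inj₁ φ²x≡φy  = φ²≢φα x φ²x≡φy
      ...   | inj₂ φ²x≡αφy = not-glued φx≡αφ²y φ²x≡αφy

      edge-φ²≢edge-φα : edge (φ² x) ≢ edge (φ y)
      edge-φ²≢edge-φα e with edge≡⇒≡⊎≡α e
      ... | inj₁ φ²x≡φy = φ²≢φα x φ²x≡φy
      ... | inj₂ φ²x≡αφy with edge≡⇒≡⊎≡α (edge-φ≡edge-φ²α x φ²x≡αφy)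
      ...   | inj₁ φx≡φ²y  = φ≢φ²α x φx≡φ²y
      ...   | inj₂ φx≡αφ²y = not-glued φx≡αφ²y φ²x≡αφy

      bounded-edge-degree : degH (edge x) ≡ 4
      bounded-edge-degree = begin
        degH (edge x)
          ≡⟨ cong length (filter-≐ (T? ∘ adjH (edge x)) (_∈? around) (adjH⇒∈ , ∈⇒adjH) (allFin m)) ⟩
        length (filter (_∈? around) (allFin m))
          ≡⟨ length-filter-∈ _≟_ around-unique (allFin⁺ m) (λ {e} _ → ∈-allFin e) ⟩
        4 ∎
        where
        open import Data.List.Membership.DecPropositional _≟_ using (_∈?_)

        around : List (Fin m)
        around = edge (φ x) ∷ edge (φ² x) ∷ edge (φ y) ∷ edge (φ² y) ∷ []

        around-unique : Unique around
        around-unique = (edge-φ≢ (φ x) ∘ sym ∷ edge-φ≢edge-φα x ∷ edge-φ≢edge-φ²α ∷ [])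
                      ∷ (edge-φ²≢edge-φα ∷ edge-φ²≢edge-φ²α x ∷ [])
                      ∷ (edge-φ≢ (φ y) ∘ sym ∷ [])
                      ∷ [] ∷ []

        adjH⇒∈ : ∀ {e} → T (adjH (edge x) e) → e ∈ around
        adjH⇒∈ t with adjH⇒neighbour x t
        ... | inj₁ (_ , inj₁ refl) = here refl
        ... | inj₁ (_ , inj₂ refl) = there (here refl)
        ... | inj₂ (_ , inj₁ refl) = there (there (here refl))
        ... | inj₂ (_ , inj₂ refl) = there (there (there (here refl)))

        ∈⇒adjH : ∀ {e} → e ∈ around → T (adjH (edge x) e)
        ∈⇒adjH (here refl)                          = neighbour⇒adjH bounded-x (inj₁ refl)
        ∈⇒adjH (there (here refl))                  = neighbour⇒adjH bounded-x (inj₂ refl)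
        ∈⇒adjH (there (there (here refl)))          = neighbour⇒adjH bounded-y (inj₁ refl)
        ∈⇒adjH (there (there (there (here refl))))  = neighbour⇒adjH bounded-y (inj₂ refl)
        ∈⇒adjH (there (there (there (there ()))))

corollary8 : (m : ℕ) (M : Map m) → IsSphereTriangulation M → 3 ≤ Map.nV M →
    (o : Dart m) (v : Fin m) → Conjugate.IsCutVertex M o v →
    Conjugate.degH M o v ≡ 4
corollary8 m M TS _ o v cut = degree (FaceOf? o (v , false)) (FaceOf? o (v , true))
  where
  open Triangulation TS
  open Conjugate M o using (degH)
  degree : Dec (FaceOf o (v , false)) → Dec (FaceOf o (v , true)) → degH v ≡ 4
  degree (yes outer)    _             = ⊥-elim (outer-edge-not-cut o outer cut)
  degree (no _)         (yes outer)   = ⊥-elim (outer-edge-not-cut o outer cut)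
  degree (no bounded₀)  (no bounded₁) = bounded-edge-degree o bounded₀ bounded₁
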